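{- Let $\mathbb{F}_q$ be a finite field with $q\equiv 1\pmod{9}$, let $s=(q-1)/3$, let $\mu_3=\{u\in\mathbb{F}_q^*: u^3=1\}$, let $k$ be a positive integer and $r=1+ks$. Let $c\colon\mu_3\to\mathbb{F}_q^*$ be a function with $c(u)^s=1$ for all $u\in\mu_3$. Define $f\colon\mathbb{F}_q\to\mathbb{F}_q$ by $f(0)=0$ and $f(x)=x^r\,c(x^s)$ for $x\in\mathbb{F}_q^*$. For each $u\in\mu_3$ set $\tau(u)=1+c(u)\,u^k$ and $v(u)=\tau(u)^s$. Suppose there is $\alpha\in\mu_3$ with $v(u)=\alpha$ for all $u\in\mu_3$. Then $\tau(u)\neq0$ for all $u\in\mu_3$, the map $u\mapsto u\cdot v(u)$ is a permutation of $\mu_3$, and $f$ is a complete permutation polynomial of $\mathbb{F}_q$, i.e., both $x\mapsto f(x)$ and $x\mapsto f(x)+x$ are bijections of $\mathbb{F}_q$.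
   Context: A complete permutation polynomial of $\mathbb{F}_q$ is a polynomial (equivalently, a function $\mathbb{F}_q\to\mathbb{F}_q$) $f$ such that both $x\mapsto f(x)$ and $x\mapsto f(x)+x$ are permutations of $\mathbb{F}_q$. For $x\in\mathbb{F}_q^*$ one has $x^s\in\mu_3$, so $c(x^s)$ is defined. -}

module Defs where

open import Data.Nat using (ℕ; zero; suc)
open import Data.Fin using (Fin)
import Data.Fin as Fin
open import Data.Product using (Σ; ∃; _,_; proj₁; _×_)
open import Function.Bundles using (_↔_; Inverse)
open import Function.Definitions using (Bijective)
open import Algebra.Structures using (IsCommutativeRing)
open import Relation.Nullary using (¬_; Dec; yes; no)
open import Relation.Binary.PropositionalEquality
  using (_≡_; _≢_; refl; sym; trans; cong)

-- A finite field, with propositional equality as its equality: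
-- a commutative ring with 0 ≠ 1 in which every nonzero element has a
-- multiplicative inverse, together with an enumeration of its elements
-- by Fin size (so size = q is the order of the field).
record FiniteField : Set₁ where
  infixl 6 _+_
  infixl 7 _*_
  infix  4 _≟_
  infixr 8 _^_
  field
    Carrier : Set
    _+_ _*_ : Carrier → Carrier → Carrier
    -_ : Carrier → Carrier
    0# 1# : Carrier
    isCommutativeRing : IsCommutativeRing _≡_ _+_ _*_ -_ 0# 1#
    0≢1 : 0# ≢ 1#
    inverse : ∀ x → x ≢ 0# → ∃ λ y → x * y ≡ 1#
    size : ℕ
    enumeration : Fin size ↔ Carrier

  _^_ : Carrier → ℕ → Carrier
  x ^ zero  = 1#
  x ^ suc n = x * (x ^ n)

  _≟_ : (x y : Carrier) → Dec (x ≡ y)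
  x ≟ y with Inverse.from enumeration x Fin.≟ Inverse.from enumeration y
  ... | yes p = yes (trans (sym (Inverse.strictlyInverseˡ enumeration x))
                     (trans (cong (Inverse.to enumeration) p)
                            (Inverse.strictlyInverseˡ enumeration y)))
  ... | no ¬p = no (λ x≡y → ¬p (cong (Inverse.from enumeration) x≡y))

  -- μ₃ = { u ∈ F_q^* : u^3 = 1 }  (u^3 = 1 already forces u ≠ 0)
  μ₃ : Set
  μ₃ = Σ Carrier λ u → u ^ 3 ≡ 1#

  _≈μ_ : μ₃ → μ₃ → Set
  u ≈μ w = proj₁ u ≡ proj₁ w

  -- The function f of the corollary: f(0) = 0 and f(x) = x^r c(x^s) for x ≠ 0.
  -- For x ≠ 0 one has (x^s)^3 = 1, so the last clause below is never
  -- reached in the situation of the corollary; it only makes the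
  -- definition total.
  fPoly : (s r : ℕ) → (μ₃ → Carrier) → Carrier → Carrier
  fPoly s r c x with x ≟ 0#
  ... | yes _ = 0#
  ... | no  _ with (x ^ s) ^ 3 ≟ 1#
  ...   | yes p = (x ^ r) * c (x ^ s , p)
  ...   | no  _ = 0#

  IsCompletePermutation : (Carrier → Carrier) → Set
  IsCompletePermutation f =
    Bijective _≡_ _≡_ f × Bijective _≡_ _≡_ (λ x → f x + x)

-- For x ≠ 0 the power x^s lies in μ₃, and both f and f + id have the shape x ↦ x · h(x^s)
-- with h nonvanishing on μ₃: h(u) = c(u) u^k for f, and h = τ for f + id. Such a map is
-- injective as soon as u ↦ u · h(u)^s is: raising x h(x^s) = y h(y^s) to the s-th power
-- gives x^s h(x^s)^s = y^s h(y^s)^s, so x^s = y^s, and cancelling h(x^s) = h(y^s) gives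
-- x = y. For f, h(u)^s = c(u)^s (u^s)^k = 1 because 3 ∣ s; for f + id, h(u)^s = α ≠ 0.
-- Injective self-maps of a finite set are bijective. The only fact about finite fields
-- needed is x^(q-1) = 1, obtained by comparing the product of all nonzero elements with
-- the product of their multiples by x.
module Submission where

open import Defs
open import Data.Nat using (ℕ; _∸_; _≤_; _%_; _/_)
open import Data.Product using (Σ; ∃; _×_; _,_; proj₁)
open import Function.Definitions using (Bijective)
open import Relation.Binary.PropositionalEquality using (_≡_; _≢_)

import Data.Nat as ℕ
open import Data.Nat using (zero; suc; NonZero; ≢-nonZero)
import Data.Nat.Properties as ℕₚ
open import Data.Nat.DivMod using (m≡m%n+[m/n]*n; m*n/n≡m)
open import Data.Nat.Divisibility using (_∣_; divides; ∣n⇒∣m*n)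
open import Data.Fin using (Fin; zero; suc; punchIn; punchOut)
import Data.Fin.Properties as Fin
open import Data.Product using (proj₂)
open import Data.Empty using (⊥-elim)
open import Relation.Nullary using (yes; no)
open import Relation.Binary.PropositionalEquality
  using (refl; sym; trans; cong; cong₂; module ≡-Reasoning)
open import Function.Base using (_∘_)
open import Function.Bundles using (_↔_; Inverse; mk↔ₛ′)
open import Function.Properties.Inverse using (↔-trans; ↔-sym)
open import Function.Definitions using (Injective; Surjective)
open import Algebra.Structures using (IsCommutativeRing)
open import Algebra.Bundles using (CommutativeMonoid)
import Algebra.Properties.CommutativeMonoid.Sum as ProductProperties
import Algebra.Properties.CommutativeSemigroup as CommutativeSemigroupProperties
open import Axiom.UniquenessOfIdentityProofs using (module Decidable⇒UIP)

module _ {q : ℕ} (q%9≡1 : q % 9 ≡ 1) where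

  q∸1≡[q/9]*9 : q ∸ 1 ≡ q / 9 ℕ.* 9
  q∸1≡[q/9]*9 = cong (_∸ 1) (trans (m≡m%n+[m/n]*n q 9) (cong (ℕ._+ q / 9 ℕ.* 9) q%9≡1))

  [q∸1]/3≡[q/9]*3 : (q ∸ 1) / 3 ≡ q / 9 ℕ.* 3
  [q∸1]/3≡[q/9]*3 =
    trans (cong (_/ 3) (trans q∸1≡[q/9]*9 (sym (ℕₚ.*-assoc (q / 9) 3 3))))
          (m*n/n≡m (q / 9 ℕ.* 3) 3)

  [q∸1]/3*3≡q∸1 : (q ∸ 1) / 3 ℕ.* 3 ≡ q ∸ 1
  [q∸1]/3*3≡q∸1 =
    trans (cong (ℕ._* 3) [q∸1]/3≡[q/9]*3)
          (trans (ℕₚ.*-assoc (q / 9) 3 3) (sym q∸1≡[q/9]*9))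

  3∣[q∸1]/3 : 3 ∣ (q ∸ 1) / 3
  3∣[q∸1]/3 = divides (q / 9) [q∸1]/3≡[q/9]*3

Fin-injective⇒surjective : ∀ {n} (f : Fin n → Fin n) → Injective _≡_ _≡_ f →
                           ∀ j → ∃ λ i → f i ≡ j
Fin-injective⇒surjective {suc n} f f-inj j with Fin.any? (λ i → f i Fin.≟ j)
... | yes hit = hit
... | no  miss = ⊥-elim (ℕₚ.<-irrefl refl (Fin.injective⇒≤ avoid-j-injective))
  where
  avoid-j : Fin (suc n) → Fin n
  avoid-j i = punchOut {i = j} (λ j≡fi → miss (i , sym j≡fi))

  avoid-j-injective : Injective _≡_ _≡_ avoid-j
  avoid-j-injective eq = f-inj (Fin.punchOut-injective {i = j} _ _ eq)

module _ {n} {A : Set} (enum : Fin n ↔ A) where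
  open Inverse enum

  private
    from-injective : Injective _≡_ _≡_ from
    from-injective {x} {y} eq =
      trans (sym (strictlyInverseˡ x)) (trans (cong to eq) (strictlyInverseˡ y))

    to-injective : Injective _≡_ _≡_ to
    to-injective {i} {j} eq =
      trans (sym (strictlyInverseʳ i)) (trans (cong from eq) (strictlyInverseʳ j))

  injective⇒bijective : (f : A → A) → Injective _≡_ _≡_ f → Bijective _≡_ _≡_ f
  injective⇒bijective f f-inj = f-inj , surjective
    where
    surjective : Surjective _≡_ _≡_ f
    surjective y
      with i , hit ← Fin-injective⇒surjective (from ∘ f ∘ to)
                       (λ eq → to-injective (f-inj (from-injective eq))) (from y)
      = to i , λ { refl → from-injective hit }

  distinct⇒2≤ : {a b : A} → a ≢ b → 2 ≤ n
  distinct⇒2≤ {a} {b} a≢b = Fin.injective⇒≤ pick-injective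
    where
    pick : Fin 2 → Fin n
    pick zero    = from a
    pick (suc _) = from b

    pick-injective : Injective _≡_ _≡_ pick
    pick-injective {zero}     {zero}     _  = refl
    pick-injective {zero}     {suc zero} eq = ⊥-elim (a≢b (from-injective eq))
    pick-injective {suc zero} {zero}     eq = ⊥-elim (a≢b (sym (from-injective eq)))
    pick-injective {suc zero} {suc zero} _  = refl

module Properties (𝔽 : FiniteField) where
  open FiniteField 𝔽
  open IsCommutativeRing isCommutativeRing
    using (+-comm; +-identityʳ; *-assoc; *-comm; *-identityˡ; *-identityʳ;
           zeroˡ; zeroʳ; distribˡ; *-isCommutativeMonoid)
  open ≡-Reasoning

  *-commutativeMonoid : CommutativeMonoid _ _
  *-commutativeMonoid = record { isCommutativeMonoid = *-isCommutativeMonoid }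

  open CommutativeSemigroupProperties
    (CommutativeMonoid.commutativeSemigroup *-commutativeMonoid) using (interchange)

  ^-homo-* : ∀ x m n → x ^ (m ℕ.+ n) ≡ x ^ m * x ^ n
  ^-homo-* x zero    n = sym (*-identityˡ _)
  ^-homo-* x (suc m) n = trans (cong (x *_) (^-homo-* x m n)) (sym (*-assoc x _ _))

  ^-distrib-* : ∀ x y n → (x * y) ^ n ≡ x ^ n * y ^ n
  ^-distrib-* x y zero    = sym (*-identityˡ 1#)
  ^-distrib-* x y (suc n) = trans (cong ((x * y) *_) (^-distrib-* x y n)) (interchange x y _ _)

  1^n≡1 : ∀ n → 1# ^ n ≡ 1#
  1^n≡1 zero    = refl
  1^n≡1 (suc n) = trans (*-identityˡ _) (1^n≡1 n)

  ^-assocʳ : ∀ x m n → x ^ (m ℕ.* n) ≡ (x ^ m) ^ n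
  ^-assocʳ x zero    n = sym (1^n≡1 n)
  ^-assocʳ x (suc m) n = begin
    x ^ (n ℕ.+ m ℕ.* n)    ≡⟨ ^-homo-* x n (m ℕ.* n) ⟩
    x ^ n * x ^ (m ℕ.* n)  ≡⟨ cong (x ^ n *_) (^-assocʳ x m n) ⟩
    x ^ n * (x ^ m) ^ n    ≡⟨ ^-distrib-* x (x ^ m) n ⟨
    (x * x ^ m) ^ n        ∎

  0^n≡0 : ∀ n → .{{NonZero n}} → 0# ^ n ≡ 0#
  0^n≡0 (suc n) = zeroˡ _

  *-cancelʳ-≢0 : ∀ {a b c} → c ≢ 0# → a * c ≡ b * c → a ≡ b
  *-cancelʳ-≢0 {a} {b} {c} c≢0 ac≡bc = begin
    a            ≡⟨ undo a ⟨
    a * c * c⁻¹  ≡⟨ cong (_* c⁻¹) ac≡bc ⟩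
    b * c * c⁻¹  ≡⟨ undo b ⟩
    b            ∎
    where
    c⁻¹ : Carrier
    c⁻¹ = proj₁ (inverse c c≢0)
    undo : ∀ x → x * c * c⁻¹ ≡ x
    undo x = trans (*-assoc x c c⁻¹) (trans (cong (x *_) (proj₂ (inverse c c≢0))) (*-identityʳ x))

  *-≢0 : ∀ {a b} → a ≢ 0# → b ≢ 0# → a * b ≢ 0#
  *-≢0 {a} {b} a≢0 b≢0 ab≡0 = a≢0 (*-cancelʳ-≢0 b≢0 (trans ab≡0 (sym (zeroˡ b))))

  1≢0 : 1# ≢ 0#
  1≢0 1≡0 = 0≢1 (sym 1≡0)

  ^-≢0 : ∀ {x} n → x ≢ 0# → x ^ n ≢ 0#
  ^-≢0 zero    _   = 1≢0
  ^-≢0 (suc n) x≢0 = *-≢0 x≢0 (^-≢0 n x≢0)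

  2≤size : 2 ≤ size
  2≤size = distinct⇒2≤ enumeration 0≢1

  *-↔ : ∀ {x} → x ≢ 0# → Carrier ↔ Carrier
  *-↔ {x} x≢0 =
    mk↔ₛ′ (x *_) (x⁻¹ *_) (cancel x x⁻¹ xx⁻¹≡1) (cancel x⁻¹ x (trans (*-comm x⁻¹ x) xx⁻¹≡1))
    where
    x⁻¹ : Carrier
    x⁻¹ = proj₁ (inverse x x≢0)
    xx⁻¹≡1 : x * x⁻¹ ≡ 1#
    xx⁻¹≡1 = proj₂ (inverse x x≢0)
    cancel : ∀ a b → a * b ≡ 1# → ∀ y → a * (b * y) ≡ y
    cancel a b ab≡1 y = trans (sym (*-assoc a b y)) (trans (cong (_* y) ab≡1) (*-identityˡ y))

  -- Over the multiplicative monoid, the library's Π.sum is a product.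
  private
    module Π = ProductProperties *-commutativeMonoid
    e : Fin size → Carrier
    e = Inverse.to enumeration
    e⁻¹ : Carrier → Fin size
    e⁻¹ = Inverse.from enumeration

  product-const : ∀ n x → Π.sum {n} (λ _ → x) ≡ x ^ n
  product-const zero    x = refl
  product-const (suc n) x = cong (x *_) (product-const n x)

  product-≢0 : ∀ {n} (h : Fin n → Carrier) → (∀ i → h i ≢ 0#) → Π.sum h ≢ 0#
  product-≢0 {zero}  h _   = 1≢0
  product-≢0 {suc n} h h≢0 = *-≢0 (h≢0 zero) (product-≢0 (h ∘ suc) (h≢0 ∘ suc))

  product-const-except : ∀ {n} (h : Fin n → Carrier) (i : Fin n) {x} → h i ≡ 1# →
                         (∀ j → j ≢ i → h j ≡ x) → Π.sum h ≡ x ^ (n ∸ 1)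
  product-const-except {suc n} h i {x} hᵢ≡1 hⱼ≡x = begin
    Π.sum h                         ≡⟨ Π.sum-remove {i = i} h ⟩
    h i * Π.sum (h ∘ punchIn i)     ≡⟨ cong₂ _*_ hᵢ≡1 (Π.sum-cong-≗ λ j →
                                         hⱼ≡x _ (Fin.punchInᵢ≢i i j)) ⟩
    1# * Π.sum {n} (λ _ → x)        ≡⟨ *-identityˡ _ ⟩
    Π.sum {n} (λ _ → x)             ≡⟨ product-const n x ⟩
    x ^ n                           ∎

  ∏ : (Carrier → Carrier) → Carrier
  ∏ h = Π.sum (h ∘ e)

  ∏-reindex : (σ : Carrier ↔ Carrier) (h : Carrier → Carrier) → ∏ h ≡ ∏ (h ∘ Inverse.to σ)
  ∏-reindex σ h =
    trans (Π.sum-permute (h ∘ e) (↔-trans (↔-trans enumeration σ) (↔-sym enumeration)))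
          (Π.sum-cong-≗ {size} λ i → cong h (Inverse.strictlyInverseˡ enumeration _))

  ifNonzero : Carrier → Carrier → Carrier
  ifNonzero y a with y ≟ 0#
  ... | yes _ = 1#
  ... | no  _ = a

  ifNonzero-≡0 : ∀ {y} a → y ≡ 0# → ifNonzero y a ≡ 1#
  ifNonzero-≡0 {y} a y≡0 with y ≟ 0#
  ... | yes _   = refl
  ... | no  y≢0 = ⊥-elim (y≢0 y≡0)

  ifNonzero-≢0 : ∀ {y} a → y ≢ 0# → ifNonzero y a ≡ a
  ifNonzero-≢0 {y} a y≢0 with y ≟ 0#
  ... | yes y≡0 = ⊥-elim (y≢0 y≡0)
  ... | no  _   = refl

  ifNonzero-self-≢0 : ∀ y → ifNonzero y y ≢ 0#
  ifNonzero-self-≢0 y with y ≟ 0#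
  ... | yes _   = 1≢0
  ... | no  y≢0 = y≢0

  ifNonzero-* : ∀ {x} → x ≢ 0# → ∀ y → ifNonzero (x * y) (x * y) ≡ ifNonzero y x * ifNonzero y y
  ifNonzero-* {x} x≢0 y with y ≟ 0#
  ... | yes y≡0 = trans (ifNonzero-≡0 _ (trans (cong (x *_) y≡0) (zeroʳ x))) (sym (*-identityˡ 1#))
  ... | no  y≢0 = ifNonzero-≢0 _ (*-≢0 x≢0 y≢0)

  ∏-ifNonzero : ∀ x → ∏ (λ y → ifNonzero y x) ≡ x ^ (size ∸ 1)
  ∏-ifNonzero x = product-const-except _ (e⁻¹ 0#)
    (ifNonzero-≡0 x (Inverse.strictlyInverseˡ enumeration 0#))
    (λ j j≢ → ifNonzero-≢0 x λ eⱼ≡0 →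
       j≢ (trans (sym (Inverse.strictlyInverseʳ enumeration j)) (cong e⁻¹ eⱼ≡0)))

  fermat : ∀ {x} → x ≢ 0# → x ^ (size ∸ 1) ≡ 1#
  fermat {x} x≢0 = *-cancelʳ-≢0 (product-≢0 (unit ∘ e) (ifNonzero-self-≢0 ∘ e)) (begin
    x ^ (size ∸ 1) * ∏ unit                 ≡⟨ cong (_* ∏ unit) (∏-ifNonzero x) ⟨
    ∏ (λ y → ifNonzero y x) * ∏ unit        ≡⟨ Π.∑-distrib-+ (λ i → ifNonzero (e i) x) (unit ∘ e) ⟨
    ∏ (λ y → ifNonzero y x * unit y)        ≡⟨ Π.sum-cong-≗ (ifNonzero-* x≢0 ∘ e) ⟨
    ∏ (unit ∘ (x *_))                       ≡⟨ ∏-reindex (*-↔ x≢0) unit ⟨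
    ∏ unit                                  ≡⟨ *-identityˡ _ ⟨
    1# * ∏ unit                             ∎)
    where
    unit : Carrier → Carrier
    unit y = ifNonzero y y

  ≈μ⇒≡ : ∀ {u w : μ₃} → u ≈μ w → u ≡ w
  ≈μ⇒≡ {u , p} {.u , q} refl = cong (u ,_) (Decidable⇒UIP.≡-irrelevant _≟_ p q)

  μ₃-≢0 : (u : μ₃) → proj₁ u ≢ 0#
  μ₃-≢0 (u , u³≡1) u≡0 = 0≢1 (begin
    0#       ≡⟨ 0^n≡0 3 ⟨
    0# ^ 3   ≡⟨ cong (_^ 3) u≡0 ⟨
    u ^ 3    ≡⟨ u³≡1 ⟩
    1#       ∎)

  μ₃-^-3∣ : (u : μ₃) → ∀ {n} → 3 ∣ n → proj₁ u ^ n ≡ 1#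
  μ₃-^-3∣ (u , u³≡1) (divides t refl) = begin
    u ^ (t ℕ.* 3)   ≡⟨ cong (u ^_) (ℕₚ.*-comm t 3) ⟩
    u ^ (3 ℕ.* t)   ≡⟨ ^-assocʳ u 3 t ⟩
    (u ^ 3) ^ t     ≡⟨ cong (_^ t) u³≡1 ⟩
    1# ^ t          ≡⟨ 1^n≡1 t ⟩
    1#              ∎

  _·_ : μ₃ → μ₃ → μ₃
  (u , u³≡1) · (w , w³≡1) =
    u * w , trans (^-distrib-* u w 3) (trans (cong₂ _*_ u³≡1 w³≡1) (*-identityˡ 1#))

  ·-bijectiveʳ : (α : μ₃) → Bijective _≈μ_ _≈μ_ (_· α)
  ·-bijectiveʳ α@(a , a³≡1) =
    *-cancelʳ-≢0 (μ₃-≢0 α) , λ w → (w · α) · α , λ { refl → cube (proj₁ w) }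
    where
    cube : ∀ w → w * a * a * a ≡ w
    cube w = begin
      w * a * a * a          ≡⟨ *-assoc (w * a) a a ⟩
      w * a * (a * a)        ≡⟨ *-assoc w a (a * a) ⟩
      w * (a * (a * a))      ≡⟨ cong (λ z → w * (a * (a * z))) (*-identityʳ a) ⟨
      w * a ^ 3              ≡⟨ cong (w *_) a³≡1 ⟩
      w * 1#                 ≡⟨ *-identityʳ w ⟩
      w                      ∎

  module Exponent (s : ℕ) (s*3≡q∸1 : s ℕ.* 3 ≡ size ∸ 1) where

    instance
      s-nonZero : NonZero s
      s-nonZero = ≢-nonZero λ s≡0 →
        ℕₚ.≤⇒≯ (ℕₚ.m∸n≡0⇒m≤n (trans (sym s*3≡q∸1) (cong (ℕ._* 3) s≡0))) 2≤size

    powμ : (x : Carrier) → x ≢ 0# → μ₃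
    powμ x x≢0 = x ^ s , trans (sym (^-assocʳ x s 3)) (trans (cong (x ^_) s*3≡q∸1) (fermat x≢0))

    ^s∈μ₃⇒≢0 : (α : μ₃) → ∀ {y} → y ^ s ≡ proj₁ α → y ≢ 0#
    ^s∈μ₃⇒≢0 α {y} yˢ≡α y≡0 = μ₃-≢0 α (trans (sym yˢ≡α) (trans (cong (_^ s) y≡0) (0^n≡0 s)))

    x*h[xˢ]-bijective : (h : μ₃ → Carrier) → (∀ u → h u ≢ 0#) →
                        Injective _≈μ_ _≡_ (λ u → proj₁ u * h u ^ s) →
                        (φ : Carrier → Carrier) → φ 0# ≡ 0# →
                        (∀ x (x≢0 : x ≢ 0#) → φ x ≡ x * h (powμ x x≢0)) →
                        Bijective _≡_ _≡_ φ
    x*h[xˢ]-bijective h h≢0 twist-injective φ φ0≡0 φ≡ =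
      injective⇒bijective enumeration φ φ-injective
      where
      φ-≢0 : ∀ {x} → x ≢ 0# → φ x ≢ 0#
      φ-≢0 {x} x≢0 φx≡0 = *-≢0 x≢0 (h≢0 _) (trans (sym (φ≡ x x≢0)) φx≡0)

      φˢ : ∀ x (x≢0 : x ≢ 0#) → φ x ^ s ≡ x ^ s * h (powμ x x≢0) ^ s
      φˢ x x≢0 = trans (cong (_^ s) (φ≡ x x≢0)) (^-distrib-* x _ s)

      injective-off-0 : ∀ {x y} (x≢0 : x ≢ 0#) (y≢0 : y ≢ 0#) → φ x ≡ φ y → x ≡ y
      injective-off-0 {x} {y} x≢0 y≢0 φx≡φy = *-cancelʳ-≢0 (h≢0 (powμ x x≢0)) (begin
        x * h (powμ x x≢0)   ≡⟨ φ≡ x x≢0 ⟨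
        φ x                  ≡⟨ φx≡φy ⟩
        φ y                  ≡⟨ φ≡ y y≢0 ⟩
        y * h (powμ y y≢0)   ≡⟨ cong (λ u → y * h u) (≈μ⇒≡ xˢ≡yˢ) ⟨
        y * h (powμ x x≢0)   ∎)
        where
        xˢ≡yˢ : powμ x x≢0 ≈μ powμ y y≢0
        xˢ≡yˢ = twist-injective (trans (sym (φˢ x x≢0)) (trans (cong (_^ s) φx≡φy) (φˢ y y≢0)))

      φ-injective : Injective _≡_ _≡_ φ
      φ-injective {x} {y} φx≡φy with x ≟ 0# | y ≟ 0#
      ... | yes x≡0 | yes y≡0 = trans x≡0 (sym y≡0)
      ... | yes x≡0 | no  y≢0 = ⊥-elim (φ-≢0 y≢0 (trans (sym φx≡φy) (trans (cong φ x≡0) φ0≡0)))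
      ... | no  x≢0 | yes y≡0 = ⊥-elim (φ-≢0 x≢0 (trans φx≡φy (trans (cong φ y≡0) φ0≡0)))
      ... | no  x≢0 | no  y≢0 = injective-off-0 x≢0 y≢0 φx≡φy

    fPoly-0 : ∀ r c → fPoly s r c 0# ≡ 0#
    fPoly-0 r c with 0# ≟ 0#
    ... | yes _   = refl
    ... | no  0≢0 = ⊥-elim (0≢0 refl)

    fPoly-≢0 : ∀ r c {x} (x≢0 : x ≢ 0#) → fPoly s r c x ≡ x ^ r * c (powμ x x≢0)
    fPoly-≢0 r c {x} x≢0 with x ≟ 0#
    ... | yes x≡0 = ⊥-elim (x≢0 x≡0)
    ... | no  _ with (x ^ s) ^ 3 ≟ 1#
    ...   | yes _      = cong (λ u → x ^ r * c u) (≈μ⇒≡ refl)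
    ...   | no  xˢ∉μ₃ = ⊥-elim (xˢ∉μ₃ (proj₂ (powμ x x≢0)))

    module _ (k : ℕ) (c : μ₃ → Carrier) where

      f : Carrier → Carrier
      f = fPoly s (1 ℕ.+ k ℕ.* s) c

      h : μ₃ → Carrier
      h u = c u * proj₁ u ^ k

      f≡x*h[xˢ] : ∀ x (x≢0 : x ≢ 0#) → f x ≡ x * h (powμ x x≢0)
      f≡x*h[xˢ] x x≢0 = begin
        f x                          ≡⟨ fPoly-≢0 _ c x≢0 ⟩
        x * x ^ (k ℕ.* s) * c u      ≡⟨ cong (λ z → x * x ^ z * c u) (ℕₚ.*-comm k s) ⟩
        x * x ^ (s ℕ.* k) * c u      ≡⟨ cong (λ z → x * z * c u) (^-assocʳ x s k) ⟩
        x * (x ^ s) ^ k * c u        ≡⟨ *-assoc x _ (c u) ⟩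
        x * ((x ^ s) ^ k * c u)      ≡⟨ cong (x *_) (*-comm _ (c u)) ⟩
        x * h u                      ∎
        where
        u : μ₃
        u = powμ x x≢0

      fPoly-bijective : 3 ∣ s → (∀ u → c u ≢ 0#) → (∀ u → c u ^ s ≡ 1#) →
                        Bijective _≡_ _≡_ f
      fPoly-bijective 3∣s c≢0 cˢ≡1 =
        x*h[xˢ]-bijective h h≢0 (λ {u} {w} eq → trans (sym (twist≡id u)) (trans eq (twist≡id w)))
          f (fPoly-0 _ c) f≡x*h[xˢ]
        where
        h≢0 : ∀ u → h u ≢ 0#
        h≢0 u = *-≢0 (c≢0 u) (^-≢0 k (μ₃-≢0 u))

        twist≡id : ∀ u → proj₁ u * h u ^ s ≡ proj₁ u
        twist≡id u@(z , _) = begin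
          z * h u ^ s                    ≡⟨ cong (z *_) (^-distrib-* (c u) (z ^ k) s) ⟩
          z * (c u ^ s * (z ^ k) ^ s)    ≡⟨ cong (λ w → z * (c u ^ s * w)) (^-assocʳ z k s) ⟨
          z * (c u ^ s * z ^ (k ℕ.* s))  ≡⟨ cong₂ (λ a b → z * (a * b))
                                              (cˢ≡1 u) (μ₃-^-3∣ u (∣n⇒∣m*n k 3∣s)) ⟩
          z * (1# * 1#)                  ≡⟨ cong (z *_) (*-identityˡ 1#) ⟩
          z * 1#                         ≡⟨ *-identityʳ z ⟩
          z                              ∎

      fPoly+id-bijective : (α : μ₃) → (∀ u → (1# + h u) ^ s ≡ proj₁ α) →
                           Bijective _≡_ _≡_ (λ x → f x + x)
      fPoly+id-bijective α τˢ≡α =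
        x*h[xˢ]-bijective τ (λ u → ^s∈μ₃⇒≢0 α (τˢ≡α u))
          (λ {u} {w} eq → *-cancelʳ-≢0 (μ₃-≢0 α)
             (trans (cong (proj₁ u *_) (sym (τˢ≡α u))) (trans eq (cong (proj₁ w *_) (τˢ≡α w)))))
          (λ x → f x + x) (trans (cong (_+ 0#) (fPoly-0 _ c)) (+-identityʳ 0#)) f+x≡x*τ[xˢ]
        where
        τ : μ₃ → Carrier
        τ u = 1# + h u

        f+x≡x*τ[xˢ] : ∀ x (x≢0 : x ≢ 0#) → f x + x ≡ x * τ (powμ x x≢0)
        f+x≡x*τ[xˢ] x x≢0 = begin
          f x + x             ≡⟨ cong (_+ x) (f≡x*h[xˢ] x x≢0) ⟩
          x * h u + x         ≡⟨ +-comm _ x ⟩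
          x + x * h u         ≡⟨ cong (_+ x * h u) (*-identityʳ x) ⟨
          x * 1# + x * h u    ≡⟨ distribˡ x 1# (h u) ⟨
          x * (1# + h u)      ∎
          where
          u : μ₃
          u = powμ x x≢0

corollary5p2 : (𝔽 : FiniteField) → let open FiniteField 𝔽 in
    size % 9 ≡ 1 →
    (k : ℕ) → 1 ≤ k →
    (c : μ₃ → Carrier) →
    (∀ u → c u ≢ 0#) →
    (∀ u → c u ^ ((size ∸ 1) / 3) ≡ 1#) →
    let s = (size ∸ 1) / 3
        r = 1 Data.Nat.+ k Data.Nat.* s
        τ = λ (u : μ₃) → 1# + c u * (proj₁ u ^ k)
        v = λ (u : μ₃) → τ u ^ s
    in
    (Σ μ₃ λ α → ∀ u → v u ≡ proj₁ α) →
    (∀ u → τ u ≢ 0#)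
    × (Σ (μ₃ → μ₃) λ g → (∀ u → proj₁ (g u) ≡ proj₁ u * v u) × Bijective _≈μ_ _≈μ_ g)
    × IsCompletePermutation (fPoly s r c)
corollary5p2 𝔽 q%9≡1 k _ c c≢0 cˢ≡1 (α , τˢ≡α) =
    (λ u → ^s∈μ₃⇒≢0 α (τˢ≡α u))
  , (_· α , (λ u → cong (proj₁ u *_) (sym (τˢ≡α u))) , ·-bijectiveʳ α)
  , fPoly-bijective k c (3∣[q∸1]/3 {size} q%9≡1) c≢0 cˢ≡1
  , fPoly+id-bijective k c α τˢ≡α
  where
  open FiniteField 𝔽
  open Properties 𝔽
  open Exponent ((size ∸ 1) / 3) ([q∸1]/3*3≡q∸1 {size} q%9≡1)
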